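{- Let $k\ge 3$, and let $n,q,r$ be integers with $n-k=q(k-1)+r$, $q\ge 0$ and $1\le r\le k-1$. Let $G$ be a connected $n$-vertex graph having $q+2$ subgraphs $C_0,C_1,\dots,C_{q+1}$, each isomorphic to $K_k$, and write $U_i=V(C_i)$ for $i\in\{0,\dots,q+1\}$. Suppose that (1) $E(G)=\bigcup_{i=0}^{q+1}E(C_i)$; (2) for all but at most one $j\in[q+1]$, we have $|U_j\cap(\bigcup_{i=0}^{j-1}U_i)|=1$; (3) if $j\in[q+1]$ violates (2), then $|U_j\cap(\bigcup_{i=0}^{j-1}U_i)|=k-r$ and there exists $i\in\{0,\dots,j-1\}$ with $|U_i\cap U_j|=k-r$. Then $G\in\mathcal{G}_{tree}(qK_k,L)$, where $L$ is the union of two copies of $K_k$ sharing exactly $k-r$ vertices.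
   Context: A hypergraph is linear if any two distinct hyperedges share at most one vertex. In a hypergraph, a cycle of length $\ell\ge 2$ is a set of $\ell$ hyperedges labelled $e_1,\dots,e_\ell$ for which there exist distinct vertices $v_1,\dots,v_\ell$ with $v_i\in e_i\cap e_{i+1}$ for all $i\in[\ell]$ (where $e_{\ell+1}=e_1$); a hypertree is a connected hypergraph with no cycle. For graphs $F_1,\dots,F_m$, $\mathcal{G}_{tree}(F_1,\dots,F_m)$ is the family of graphs $G$ for which there is a linear hypertree with vertex set $V(G)$ and $m$ hyperedges $E_1,\dots,E_m\subseteq V(G)$ such that (1) for every edge $uv\in E(G)$ there is $i\in[m]$ with $u,v\in E_i$, and (2) for every $i\in[m]$ the induced subgraph $G[E_i]$ is isomorphic to $F_i$. The notation $\mathcal{G}_{tree}(qK_k,L)$ means $\mathcal{G}_{tree}(F_1,\dots,F_{q+1})$ with $F_1=\dots=F_q=K_k$ and $F_{q+1}=L$. -}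

module Defs where

open import Data.Nat using (ℕ; zero; suc; _+_; _*_; _∸_; _≤_; _<_; _<?_; _%_)
open import Data.Nat.DivMod using (m%n<n)
open import Data.Bool using (Bool; true; false)
open import Data.Fin using (Fin; toℕ; fromℕ<)
open import Data.Fin.Subset using (Subset; _∈_; _∩_; ∣_∣; ⋃)
open import Data.List using (List; map; filter; allFin)
open import Data.Product using (Σ; ∃; _×_; _,_)
open import Relation.Nullary using (¬_; yes; no)
open import Relation.Nullary.Decidable using (⌊_⌋)
open import Relation.Binary.PropositionalEquality using (_≡_; _≢_)
open import Relation.Binary.Construct.Closure.ReflexiveTransitive using (Star)
open import Function.Definitions using (Injective)

record Graph (n : ℕ) : Set where
  field
    adj    : Fin n → Fin n → Bool
    adj-sym    : ∀ u v → adj u v ≡ adj v u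
    adj-irrefl : ∀ v → adj v v ≡ false

open Graph public

Edge : ∀ {n} → Graph n → Fin n → Fin n → Set
Edge G u v = adj G u v ≡ true

Connected : ∀ {n} → Graph n → Set
Connected {n} G = ∀ (u v : Fin n) → Star (Edge G) u v

K : (k : ℕ) → Graph k
K k = record { adj = λ u v → ⌊ ¬? (u Data.Fin.≟ v) ⌋ ; adj-sym = symK ; adj-irrefl = irrK }
  where
    open import Relation.Nullary.Decidable using (¬?)
    import Data.Fin
    open import Data.Fin.Properties using (_≟_)
    open import Relation.Binary.PropositionalEquality using (refl; sym)
    symK : ∀ u v → ⌊ ¬? (u Data.Fin.≟ v) ⌋ ≡ ⌊ ¬? (v Data.Fin.≟ u) ⌋
    symK u v with u Data.Fin.≟ v | v Data.Fin.≟ u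
    ... | yes _ | yes _ = refl
    ... | no _  | no _  = refl
    ... | yes p | no q  = Data.Empty.⊥-elim (q (sym p)) where import Data.Empty
    ... | no p  | yes q = Data.Empty.⊥-elim (p (sym q)) where import Data.Empty
    irrK : ∀ v → ⌊ ¬? (v Data.Fin.≟ v) ⌋ ≡ false
    irrK v with v Data.Fin.≟ v
    ... | yes _ = refl
    ... | no p  = Data.Empty.⊥-elim (p refl) where import Data.Empty

-- L k r : union of two copies of K_k sharing exactly k - r vertices
-- (for 1 ≤ r ≤ k).  Vertex set Fin (k + r); first copy A = {x | x < k},
-- second copy B = {x | r ≤ x}; |A| = |B| = k, |A ∩ B| = k - r.
-- x ~ y  iff  x ≠ y and (x, y ∈ A or x, y ∈ B).
inA : ∀ {k r} → ℕ → Fin (k + r) → Bool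
inA k x = ⌊ toℕ x <? k ⌋

inB : ∀ {k r} → ℕ → Fin (k + r) → Bool
inB r x = Data.Bool.not ⌊ toℕ x <? r ⌋ where import Data.Bool

LAdj : (k r : ℕ) → Fin (k + r) → Fin (k + r) → Bool
LAdj k r x y =
  adj (K (k + r)) x y ∧ ((inA {k} {r} k x ∧ inA {k} {r} k y) ∨ (inB {k} {r} r x ∧ inB {k} {r} r y))
  where open import Data.Bool using (_∧_; _∨_)

L : (k r : ℕ) → Graph (k + r)
L k r = record { adj = LAdj k r ; adj-sym = symL ; adj-irrefl = irrL }
  where
    open import Data.Bool using (_∧_; _∨_)
    open import Data.Bool.Properties using (∧-comm)
    open import Relation.Binary.PropositionalEquality using (refl; cong₂)
    symL : ∀ x y → LAdj k r x y ≡ LAdj k r y x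
    symL x y = cong₂ _∧_ (adj-sym (K (k + r)) x y)
      (cong₂ _∨_ (∧-comm (inA {k} {r} k x) (inA {k} {r} k y))
                 (∧-comm (inB {k} {r} r x) (inB {k} {r} r y)))
    irrL : ∀ x → LAdj k r x x ≡ false
    irrL x rewrite adj-irrefl (K (k + r)) x = refl

InducedIso : ∀ {n p} → Graph n → Subset n → Graph p → Set
InducedIso {n} {p} G E F =
  Σ (Fin p → Fin n) λ φ →
    Injective _≡_ _≡_ φ
    × (∀ a → φ a ∈ E)
    × (∀ v → v ∈ E → ∃ λ a → φ a ≡ v)
    × (∀ a b → adj G (φ a) (φ b) ≡ adj F a b)

Hypergraph : ℕ → ℕ → Set
Hypergraph n m = Fin m → Subset n

Linear : ∀ {n m} → Hypergraph n m → Set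
Linear {n} {m} E = ∀ (i j : Fin m) → i ≢ j → ∣ E i ∩ E j ∣ ≤ 1

cycSuc : ∀ {l} → Fin (suc l) → Fin (suc l)
cycSuc {l} t = fromℕ< (m%n<n (suc (toℕ t)) (suc l))

HasCycle : ∀ {n m} → Hypergraph n m → Set
HasCycle {n} {m} E =
  Σ ℕ λ l → 1 ≤ l ×
    Σ (Fin (suc l) → Fin m) λ e → Injective _≡_ _≡_ e ×
    Σ (Fin (suc l) → Fin n) λ v → Injective _≡_ _≡_ v ×
      (∀ t → v t ∈ E (e t) × v t ∈ E (e (cycSuc t)))

HConnected : ∀ {n m} → Hypergraph n m → Set
HConnected {n} {m} E =
  ∀ (u v : Fin n) → Star (λ a b → ∃ λ i → a ∈ E i × b ∈ E i) u v

Hypertree : ∀ {n m} → Hypergraph n m → Set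
Hypertree E = HConnected E × ¬ HasCycle E

InGtreeqKL : ∀ {n} → Graph n → (q k : ℕ) → {p : ℕ} → Graph p → Set
InGtreeqKL {n} G q k Lg =
  Σ (Hypergraph n (suc q)) λ E →
    Linear E × Hypertree E
    × (∀ u v → Edge G u v → ∃ λ i → u ∈ E i × v ∈ E i)
    × (∀ (i : Fin (suc q)) →
         (toℕ i < q → InducedIso G (E i) (K k))
         × (toℕ i ≡ q → InducedIso G (E i) Lg))

unionBelow : ∀ {n m} → (Fin m → Subset n) → ℕ → Subset n
unionBelow {n} {m} U j = ⋃ (map U (filter (λ i → toℕ i <? j) (allFin m)))

overlapPrev : ∀ {n m} → (Fin m → Subset n) → Fin m → ℕ
overlapPrev U j = ∣ U j ∩ unionBelow U (toℕ j) ∣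

Violates : ∀ {n m} → (Fin m → Subset n) → Fin m → Set
Violates U j = 1 ≤ toℕ j × overlapPrev U j ≢ 1

{-# OPTIONS --safe #-}
-- Call U_j (j ≥ 1) a violator if it meets U_0 ∪ … ∪ U_{j-1} in other than one vertex.
-- We find indices i < j such that every U_m with m ∉ {0, j} meets its predecessors in
-- exactly one vertex, U_j meets its predecessors only inside U_i, and |U_i ∩ U_j| = k - r.
-- If there is a violator, j is the violator and i comes from (3): U_i ∩ U_j and the
-- intersection of U_j with its predecessors both have k - r elements, so they coincide.
-- Otherwise the union of all U_m has k + (q+1)(k-1) ≤ n vertices, which forces r = k - 1,
-- and j = q+1 together with any earlier U_i through its attachment vertex will do.
-- Replacing U_i by U_i ∪ U_j and dropping U_j leaves q+1 hyperedges, and ordered by the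
-- original index each meets the union of the earlier ones in at most one vertex. Such an
-- ordering forces linearity and acyclicity: in a cycle, the hyperedge of largest index
-- would meet earlier ones in two distinct cycle vertices. The cliques U_m induce K_k, and
-- U_i ∪ U_j induces L since an edge inside it lying in another U_m would give U_m two
-- common vertices with U_i ∪ U_j.
module Submission where

open import Defs
open import Data.Bool using (true; false; T)
open import Data.Bool.Properties using (T-≡; T-∧; T-∨; ⇔→≡)
open import Data.Empty using (⊥-elim)
open import Data.Fin
  using (Fin; zero; suc; toℕ; fromℕ; fromℕ<; inject₁; punchIn; punchOut; _↑ˡ_; _↑ʳ_; splitAt; _≟_)
open import Data.Fin.Permutation.Components using (transpose; transpose-inverse)
open import Data.Fin.Properties
  using ( any?; toℕ<n; toℕ-injective; toℕ-↑ˡ; toℕ-↑ʳ; toℕ-fromℕ; toℕ-fromℕ<; toℕ-inject₁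
        ; splitAt⁻¹-↑ˡ; splitAt⁻¹-↑ʳ; suc-injective; 0≢1+n; punchIn-injective; punchInᵢ≢i
        ; punchIn-punchOut )
open import Data.Fin.Subset using (Subset; _∈_; _∉_; _⊆_; _⊂_; _∩_; _∪_; ∁; ∣_∣; ⁅_⁆; ⋃; Nonempty; Empty)
open import Data.Fin.Subset.Properties
  using ( _∈?_; x∈p∩q⁺; x∈p∩q⁻; x∈p∪q⁺; x∈p∪q⁻; p∩q⊆p; p∩q⊆q; ∩-comm; x∈∁p⇒x∉p; ∉⊥; x∈⁅x⁆
        ; x∈⁅y⁆⇒x≡y; ∣⁅x⁆∣≡1; nonempty?; Empty-unique; ∣⊥∣≡0; ⊆-antisym; ∣p∣≤n
        ; p⊆q⇒∣p∣≤∣q∣; p⊂q⇒∣p∣<∣q∣ )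
open import Data.List using (List; []; _∷_; allFin)
open import Data.List.Extrema.Nat using (argmax; f[xs]≤f[argmax])
import Data.List.Membership.Propositional as List
open import Data.List.Membership.Propositional.Properties using (∈-allFin; ∈-filter⁺; ∈-filter⁻)
import Data.List.Relation.Unary.All as All
open import Data.List.Relation.Unary.Any using (Any; here; there)
import Data.List.Relation.Unary.Any.Properties as Any
open import Data.Nat using (ℕ; zero; suc; _+_; _*_; _∸_; _≤_; _<_; _≤?_; _<?_; z≤n; s≤s)
import Data.Nat as ℕ
open import Data.Nat.DivMod using (_%_; m%n<n; n%n≡0; m<n⇒m%n≡m)
open import Data.Nat.Properties
  using ( +-assoc; +-comm; +-suc; +-identityʳ; +-cancelˡ-≤; +-cancelʳ-≡; +-monoʳ-<; m≤m+n
        ; m+n∸m≡n; m+n∸n≡m; m∸n≤m; m≤n⇒∃[o]m+o≡n; ≤-reflexive; ≤-trans; ≤-antisym; <-irrefl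
        ; <-trans; <-≤-trans; <-cmp; ≤∧≢⇒<; 1+n≢n; n<1+n; m<n⇒m<1+n; m<1+n⇒m<n∨m≡n; ≮⇒≥; ≤⇒≯; <⇒≱ )
open import Data.Product using (∃; _×_; _,_; proj₁; proj₂; map; map₂)
open import Data.Product.Function.NonDependent.Propositional using (_×-⇔_)
open import Data.Sum using (_⊎_; inj₁; inj₂; [_,_]′)
import Data.Sum as Sum
open import Data.Sum.Function.Propositional using (_⊎-⇔_)
open import Data.Vec using ([]; _∷_; here; there)
open import Data.Vec.Functional using (_++_)
open import Data.Vec.Functional.Properties using (lookup-++ˡ; lookup-++ʳ)
open import Function using (_∘_; _⇔_; mk⇔)
open import Function.Construct.Composition using (_⇔-∘_)
open import Function.Construct.Symmetry using (⇔-sym)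
open import Function.Definitions using (Injective)
open import Relation.Binary using (tri<; tri≈; tri>)
import Relation.Binary.Construct.Closure.ReflexiveTransitive as Star
open import Relation.Binary.PropositionalEquality
  using (_≡_; _≢_; refl; sym; trans; cong; cong₂; subst; subst₂; module ≡-Reasoning)
open import Relation.Nullary using (¬_; Dec; yes; no; ¬?; _×-dec_)
open import Relation.Nullary.Decidable
  using (dec-true; decidable-stable; toWitness; fromWitness; toWitnessFalse; fromWitnessFalse)

open ≡-Reasoning

private
  variable
    n : ℕ

-- Cardinalities of finite subsets

∣p∪q∣+∣p∩q∣≡∣p∣+∣q∣ : ∀ (p q : Subset n) → ∣ p ∪ q ∣ + ∣ p ∩ q ∣ ≡ ∣ p ∣ + ∣ q ∣
∣p∪q∣+∣p∩q∣≡∣p∣+∣q∣ []         []         = refl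
∣p∪q∣+∣p∩q∣≡∣p∣+∣q∣ (true ∷ p)  (true ∷ q)  =
  cong suc (trans (+-suc _ _) (trans (cong suc (∣p∪q∣+∣p∩q∣≡∣p∣+∣q∣ p q)) (sym (+-suc _ _))))
∣p∪q∣+∣p∩q∣≡∣p∣+∣q∣ (true ∷ p)  (false ∷ q) = cong suc (∣p∪q∣+∣p∩q∣≡∣p∣+∣q∣ p q)
∣p∪q∣+∣p∩q∣≡∣p∣+∣q∣ (false ∷ p) (true ∷ q)  =
  trans (cong suc (∣p∪q∣+∣p∩q∣≡∣p∣+∣q∣ p q)) (sym (+-suc _ _))
∣p∪q∣+∣p∩q∣≡∣p∣+∣q∣ (false ∷ p) (false ∷ q) = ∣p∪q∣+∣p∩q∣≡∣p∣+∣q∣ p q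

∣p∩∁q∣+∣p∩q∣≡∣p∣ : ∀ (p q : Subset n) → ∣ p ∩ ∁ q ∣ + ∣ p ∩ q ∣ ≡ ∣ p ∣
∣p∩∁q∣+∣p∩q∣≡∣p∣ []         []         = refl
∣p∩∁q∣+∣p∩q∣≡∣p∣ (true ∷ p)  (true ∷ q)  = trans (+-suc _ _) (cong suc (∣p∩∁q∣+∣p∩q∣≡∣p∣ p q))
∣p∩∁q∣+∣p∩q∣≡∣p∣ (true ∷ p)  (false ∷ q) = cong suc (∣p∩∁q∣+∣p∩q∣≡∣p∣ p q)
∣p∩∁q∣+∣p∩q∣≡∣p∣ (false ∷ p) (_ ∷ q)     = ∣p∩∁q∣+∣p∩q∣≡∣p∣ p q

∣p∣≡r+s⇒∣p∩q∣≡s⇒∣p∩∁q∣≡r : ∀ (p q : Subset n) {r s} → ∣ p ∣ ≡ r + s → ∣ p ∩ q ∣ ≡ s → ∣ p ∩ ∁ q ∣ ≡ r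
∣p∣≡r+s⇒∣p∩q∣≡s⇒∣p∩∁q∣≡r p q {r} {s} ∣p∣≡r+s ∣p∩q∣≡s = +-cancelʳ-≡ s _ r (begin
  ∣ p ∩ ∁ q ∣ + s           ≡⟨ cong (∣ p ∩ ∁ q ∣ +_) ∣p∩q∣≡s ⟨
  ∣ p ∩ ∁ q ∣ + ∣ p ∩ q ∣   ≡⟨ ∣p∩∁q∣+∣p∩q∣≡∣p∣ p q ⟩
  ∣ p ∣                     ≡⟨ ∣p∣≡r+s ⟩
  r + s                     ∎)

p∩∁q∪p∩q∪q∩∁p≡p∪q : ∀ (p q : Subset n) → (p ∩ ∁ q ∪ p ∩ q) ∪ q ∩ ∁ p ≡ p ∪ q
p∩∁q∪p∩q∪q∩∁p≡p∪q []          []          = refl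
p∩∁q∪p∩q∪q∩∁p≡p∪q (true ∷ p)  (true ∷ q)  = cong (true ∷_) (p∩∁q∪p∩q∪q∩∁p≡p∪q p q)
p∩∁q∪p∩q∪q∩∁p≡p∪q (true ∷ p)  (false ∷ q) = cong (true ∷_) (p∩∁q∪p∩q∪q∩∁p≡p∪q p q)
p∩∁q∪p∩q∪q∩∁p≡p∪q (false ∷ p) (true ∷ q)  = cong (true ∷_) (p∩∁q∪p∩q∪q∩∁p≡p∪q p q)
p∩∁q∪p∩q∪q∩∁p≡p∪q (false ∷ p) (false ∷ q) = cong (false ∷_) (p∩∁q∪p∩q∪q∩∁p≡p∪q p q)

x∈p⇒⁅x⁆⊆p : ∀ {p : Subset n} {x} → x ∈ p → ⁅ x ⁆ ⊆ p
x∈p⇒⁅x⁆⊆p {x = x} x∈p y∈⁅x⁆ = subst (_∈ _) (sym (x∈⁅y⁆⇒x≡y x y∈⁅x⁆)) x∈p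

x∈p⇒0<∣p∣ : ∀ {p : Subset n} {x} → x ∈ p → 0 < ∣ p ∣
x∈p⇒0<∣p∣ {x = x} x∈p = subst (_≤ _) (∣⁅x⁆∣≡1 x) (p⊆q⇒∣p∣≤∣q∣ (x∈p⇒⁅x⁆⊆p x∈p))

Empty⇒∣p∣≡0 : ∀ {p : Subset n} → Empty p → ∣ p ∣ ≡ 0
Empty⇒∣p∣≡0 {n} ¬ne = trans (cong ∣_∣ (Empty-unique ¬ne)) (∣⊥∣≡0 n)

0<∣p∣⇒Nonempty : ∀ (p : Subset n) → 0 < ∣ p ∣ → Nonempty p
0<∣p∣⇒Nonempty p 0<∣p∣ with nonempty? p
... | yes ne = ne
... | no ¬ne = ⊥-elim (<-irrefl (sym (Empty⇒∣p∣≡0 ¬ne)) 0<∣p∣)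

unique⇒∣p∣≤1 : ∀ (p : Subset n) → (∀ {x y} → x ∈ p → y ∈ p → x ≡ y) → ∣ p ∣ ≤ 1
unique⇒∣p∣≤1 p unique with nonempty? p
... | yes (x , x∈p) =
  subst (_ ≤_) (∣⁅x⁆∣≡1 x) (p⊆q⇒∣p∣≤∣q∣ λ y∈p → subst (_∈ ⁅ x ⁆) (unique x∈p y∈p) (x∈⁅x⁆ x))
... | no ¬ne = subst (_≤ 1) (sym (Empty⇒∣p∣≡0 ¬ne)) z≤n

∣p∣≡1⇒unique : ∀ {p : Subset n} → ∣ p ∣ ≡ 1 → ∀ {x y} → x ∈ p → y ∈ p → x ≡ y
∣p∣≡1⇒unique ∣p∣≡1 {x} {y} x∈p y∈p with x ≟ y
... | yes x≡y = x≡y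
... | no x≢y = ⊥-elim (<-irrefl (trans (∣⁅x⁆∣≡1 x) (sym ∣p∣≡1)) (p⊂q⇒∣p∣<∣q∣ ⁅x⁆⊂p))
  where
    ⁅x⁆⊂p : ⁅ x ⁆ ⊂ _
    ⁅x⁆⊂p = x∈p⇒⁅x⁆⊆p x∈p , y , y∈p , λ y∈⁅x⁆ → x≢y (sym (x∈⁅y⁆⇒x≡y x y∈⁅x⁆))

p⊆q⇒∣q∣≤∣p∣⇒q⊆p : ∀ {p q : Subset n} → p ⊆ q → ∣ q ∣ ≤ ∣ p ∣ → q ⊆ p
p⊆q⇒∣q∣≤∣p∣⇒q⊆p {p = p} p⊆q ∣q∣≤∣p∣ {x} x∈q with x ∈? p
... | yes x∈p = x∈p
... | no x∉p = ⊥-elim (<-irrefl refl (≤-trans (p⊂q⇒∣p∣<∣q∣ (p⊆q , x , x∈q , x∉p)) ∣q∣≤∣p∣))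

-- Enumerations of finite subsets

record Enumeration {n} (S : Subset n) (c : ℕ) : Set where
  field
    φ          : Fin c → Fin n
    injective  : Injective _≡_ _≡_ φ
    φ∈S        : ∀ a → φ a ∈ S
    surjective : ∀ v → v ∈ S → ∃ λ a → φ a ≡ v

enumerate : ∀ (S : Subset n) → Enumeration S ∣ S ∣
enumerate []          = record { φ = λ () ; injective = λ { {()} } ; φ∈S = λ () ; surjective = λ () }
enumerate (false ∷ S) = record
  { φ          = suc ∘ φ
  ; injective  = injective ∘ suc-injective
  ; φ∈S        = λ a → there (φ∈S a)
  ; surjective = λ { (suc v) (there v∈S) → map₂ (cong suc) (surjective v v∈S) }
  }
  where open Enumeration (enumerate S)
enumerate (true ∷ S)  = record { φ = ψ ; injective = ψ-injective ; φ∈S = ψ∈ ; surjective = ψ-surjective }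
  where
    open Enumeration (enumerate S)
    ψ : Fin (suc ∣ S ∣) → Fin _
    ψ zero    = zero
    ψ (suc a) = suc (φ a)
    ψ-injective : Injective _≡_ _≡_ ψ
    ψ-injective {zero}  {zero}  _  = refl
    ψ-injective {zero}  {suc _} eq = ⊥-elim (0≢1+n eq)
    ψ-injective {suc _} {zero}  eq = ⊥-elim (0≢1+n (sym eq))
    ψ-injective {suc _} {suc _} eq = cong suc (injective (suc-injective eq))
    ψ∈ : ∀ a → ψ a ∈ true ∷ S
    ψ∈ zero    = here
    ψ∈ (suc a) = there (φ∈S a)
    ψ-surjective : ∀ v → v ∈ true ∷ S → ∃ λ a → ψ a ≡ v
    ψ-surjective zero    _           = zero , refl
    ψ-surjective (suc v) (there v∈S) = map suc (cong suc) (surjective v v∈S)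

enumeration : ∀ {S : Subset n} {c} → ∣ S ∣ ≡ c → Enumeration S c
enumeration {S = S} refl = enumerate S

subst-Enumeration : ∀ {S T : Subset n} {c} → S ≡ T → Enumeration S c → Enumeration T c
subst-Enumeration S≡T E = record
  { φ          = φ
  ; injective  = injective
  ; φ∈S        = λ a → subst (_ ∈_) S≡T (φ∈S a)
  ; surjective = λ v v∈T → surjective v (subst (v ∈_) (sym S≡T) v∈T)
  }
  where open Enumeration E

data Split (c d : ℕ) : Fin (c + d) → Set where
  left  : (a : Fin c) → Split c d (a ↑ˡ d)
  right : (b : Fin d) → Split c d (c ↑ʳ b)

split : ∀ c d (a : Fin (c + d)) → Split c d a
split c d a with splitAt c a in eq
... | inj₁ x = subst (Split c d) (splitAt⁻¹-↑ˡ eq) (left x)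
... | inj₂ y = subst (Split c d) (splitAt⁻¹-↑ʳ eq) (right y)

enumeration-∪ : ∀ {S T : Subset n} {c d} → Enumeration S c → Enumeration T d →
  (∀ {x} → x ∈ S → x ∉ T) → Enumeration (S ∪ T) (c + d)
enumeration-∪ {n} {S} {T} {c} {d} E F disjoint =
  record { φ = φ ; injective = injective ; φ∈S = φ∈ ; surjective = surjective }
  where
    module E = Enumeration E
    module F = Enumeration F
    φ : Fin (c + d) → Fin n
    φ = E.φ ++ F.φ
    φ-left : ∀ x → φ (x ↑ˡ d) ≡ E.φ x
    φ-left = lookup-++ˡ E.φ F.φ
    φ-right : ∀ y → φ (c ↑ʳ y) ≡ F.φ y
    φ-right = lookup-++ʳ E.φ F.φ
    φ∈ : ∀ a → φ a ∈ S ∪ T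
    φ∈ a with split c d a
    ... | left  x = subst (_∈ S ∪ T) (sym (φ-left x)) (x∈p∪q⁺ (inj₁ (E.φ∈S x)))
    ... | right y = subst (_∈ S ∪ T) (sym (φ-right y)) (x∈p∪q⁺ (inj₂ (F.φ∈S y)))
    separated : ∀ x y → E.φ x ≢ F.φ y
    separated x y eq = disjoint (E.φ∈S x) (subst (_∈ T) (sym eq) (F.φ∈S y))
    injective : Injective _≡_ _≡_ φ
    injective {a} {b} eq with split c d a | split c d b
    ... | left x  | left x′  = cong (_↑ˡ d) (E.injective (trans (sym (φ-left x)) (trans eq (φ-left x′))))
    ... | left x  | right y′ = ⊥-elim (separated x y′ (trans (sym (φ-left x)) (trans eq (φ-right y′))))
    ... | right y | left x′  = ⊥-elim (separated x′ y (trans (sym (φ-left x′)) (trans (sym eq) (φ-right y))))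
    ... | right y | right y′ = cong (c ↑ʳ_) (F.injective (trans (sym (φ-right y)) (trans eq (φ-right y′))))
    surjective : ∀ v → v ∈ S ∪ T → ∃ λ a → φ a ≡ v
    surjective v v∈ with x∈p∪q⁻ S T v∈
    ... | inj₁ v∈S = let x , φx≡v = E.surjective v v∈S in x ↑ˡ d , trans (φ-left x) φx≡v
    ... | inj₂ v∈T = let y , φy≡v = F.surjective v v∈T in c ↑ʳ y , trans (φ-right y) φy≡v

-- Hypergraphs ordered by attachment

TreeOrdered : ∀ {n m} → Hypergraph n m → (Fin m → ℕ) → Set
TreeOrdered E rank = ∀ e e₁ e₂ {x y} → rank e₁ < rank e → rank e₂ < rank e →
  x ∈ E e → x ∈ E e₁ → y ∈ E e → y ∈ E e₂ → x ≡ y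

cycPred : ∀ {l} → Fin (suc l) → Fin (suc l)
cycPred {l} zero = fromℕ l
cycPred (suc t)  = inject₁ t

toℕ-cycSuc : ∀ {l} (t : Fin (suc l)) → toℕ (cycSuc t) ≡ suc (toℕ t) % suc l
toℕ-cycSuc {l} t = toℕ-fromℕ< (m%n<n (suc (toℕ t)) (suc l))

cycSuc-cycPred : ∀ {l} (t : Fin (suc l)) → cycSuc (cycPred t) ≡ t
cycSuc-cycPred {l} zero = toℕ-injective (begin
  toℕ (cycSuc (fromℕ l))      ≡⟨ toℕ-cycSuc (fromℕ l) ⟩
  suc (toℕ (fromℕ l)) % suc l ≡⟨ cong (λ i → suc i % suc l) (toℕ-fromℕ l) ⟩
  suc l % suc l               ≡⟨ n%n≡0 (suc l) ⟩
  0                           ∎)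
cycSuc-cycPred {l} (suc t) = toℕ-injective (begin
  toℕ (cycSuc (inject₁ t))      ≡⟨ toℕ-cycSuc (inject₁ t) ⟩
  suc (toℕ (inject₁ t)) % suc l ≡⟨ cong (λ i → suc i % suc l) (toℕ-inject₁ t) ⟩
  suc (toℕ t) % suc l           ≡⟨ m<n⇒m%n≡m (s≤s (toℕ<n t)) ⟩
  suc (toℕ t)                   ∎)

cycSuc-irrefl : ∀ {l} → 1 ≤ l → (t : Fin (suc l)) → cycSuc t ≢ t
cycSuc-irrefl {l} 1≤l t cycSuc-t≡t with m<1+n⇒m<n∨m≡n (toℕ<n t)
... | inj₁ t<l = 1+n≢n (begin
  suc (toℕ t)         ≡⟨ m<n⇒m%n≡m (s≤s t<l) ⟨
  suc (toℕ t) % suc l ≡⟨ toℕ-cycSuc t ⟨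
  toℕ (cycSuc t)      ≡⟨ cong toℕ cycSuc-t≡t ⟩
  toℕ t               ∎)
... | inj₂ t≡l = <-irrefl (begin
  0                   ≡⟨ n%n≡0 (suc l) ⟨
  suc l % suc l       ≡⟨ cong (λ i → suc i % suc l) t≡l ⟨
  suc (toℕ t) % suc l ≡⟨ toℕ-cycSuc t ⟨
  toℕ (cycSuc t)      ≡⟨ cong toℕ cycSuc-t≡t ⟩
  toℕ t               ≡⟨ t≡l ⟩
  l                   ∎) 1≤l

module _ {n m} {E : Hypergraph n m} {rank : Fin m → ℕ}
         (rank-injective : Injective _≡_ _≡_ rank) (ordered : TreeOrdered E rank) where

  TreeOrdered⇒meet-unique : ∀ {e e′ x y} → e ≢ e′ →
    x ∈ E e → x ∈ E e′ → y ∈ E e → y ∈ E e′ → x ≡ y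
  TreeOrdered⇒meet-unique {e} {e′} e≢e′ x∈e x∈e′ y∈e y∈e′ with <-cmp (rank e) (rank e′)
  ... | tri< e<e′ _ _ = ordered e′ e e e<e′ e<e′ x∈e′ x∈e y∈e′ y∈e
  ... | tri≈ _ e≡e′ _ = ⊥-elim (e≢e′ (rank-injective e≡e′))
  ... | tri> _ _ e′<e = ordered e e′ e′ e′<e e′<e x∈e x∈e′ y∈e y∈e′

  TreeOrdered⇒Linear : Linear E
  TreeOrdered⇒Linear e e′ e≢e′ = unique⇒∣p∣≤1 (E e ∩ E e′) λ {x} {y} x∈ y∈ →
    let x∈e , x∈e′ = x∈p∩q⁻ (E e) (E e′) x∈
        y∈e , y∈e′ = x∈p∩q⁻ (E e) (E e′) y∈
    in TreeOrdered⇒meet-unique e≢e′ x∈e x∈e′ y∈e y∈e′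

  TreeOrdered⇒Acyclic : ¬ HasCycle E
  TreeOrdered⇒Acyclic (l , 1≤l , e , e-injective , v , v-injective , v∈) =
    p≢t (v-injective (ordered (e t) (e p) (e s) (below p≢t) (below s≢t)
                              vp∈et (proj₁ (v∈ p)) (proj₁ (v∈ t)) (proj₂ (v∈ t))))
    where
      t = argmax (rank ∘ e) zero (allFin (suc l))
      p = cycPred t
      s = cycSuc t
      below : ∀ {u} → u ≢ t → rank (e u) < rank (e t)
      below {u} u≢t =
        ≤∧≢⇒< (All.lookup (f[xs]≤f[argmax] {f = rank ∘ e} zero (allFin (suc l))) (∈-allFin u))
              (u≢t ∘ e-injective ∘ rank-injective)
      s≢t : s ≢ t
      s≢t = cycSuc-irrefl 1≤l t
      p≢t : p ≢ t
      p≢t p≡t = s≢t (trans (cong cycSuc (sym p≡t)) (cycSuc-cycPred t))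
      vp∈et : v p ∈ E (e t)
      vp∈et = subst (λ u → v p ∈ E (e u)) (cycSuc-cycPred t) (proj₂ (v∈ p))

-- Induced copies of K_k and L

both-hold : ∀ {P Q : Set} → P → Q → P ⇔ Q
both-hold p q = mk⇔ (λ _ → q) (λ _ → p)

both-fail : ∀ {P Q : Set} → ¬ P → ¬ Q → P ⇔ Q
both-fail ¬p ¬q = mk⇔ (⊥-elim ∘ ¬p) (⊥-elim ∘ ¬q)

Edge-K : ∀ {k} (a b : Fin k) → Edge (K k) a b ⇔ a ≢ b
Edge-K a b with a ≟ b
... | yes a≡b = mk⇔ (λ ()) (λ a≢b → ⊥-elim (a≢b a≡b))
... | no a≢b  = mk⇔ (λ _ → a≢b) (λ _ → refl)

Edge-L : ∀ {k r} (a b : Fin (k + r)) →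
  Edge (L k r) a b ⇔ (a ≢ b × (toℕ a < k × toℕ b < k ⊎ r ≤ toℕ a × r ≤ toℕ b))
Edge-L {k} {r} a b =
  (   (Edge-K a b ⇔-∘ T-≡)
  ×-⇔ ((((T-inA a ×-⇔ T-inA b) ⇔-∘ T-∧) ⊎-⇔ ((T-inB a ×-⇔ T-inB b) ⇔-∘ T-∧)) ⇔-∘ T-∨)
  ) ⇔-∘ (T-∧ ⇔-∘ ⇔-sym T-≡)
  where
    T-inA : ∀ a → T (inA {k} {r} k a) ⇔ toℕ a < k
    T-inA a = mk⇔ toWitness fromWitness
    T-inB : ∀ a → T (inB {k} {r} r a) ⇔ r ≤ toℕ a
    T-inB a = mk⇔ (≮⇒≥ ∘ toWitnessFalse) (fromWitnessFalse ∘ ≤⇒≯)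

inducedIso : ∀ {n p} {G : Graph n} {S : Subset n} {F : Graph p} (E : Enumeration S p) →
  (∀ a b → Edge G (Enumeration.φ E a) (Enumeration.φ E b) ⇔ Edge F a b) → InducedIso G S F
inducedIso E Edge⇔ = φ , injective , φ∈S , surjective , λ a b → ⇔→≡ (Edge⇔ a b)
  where open Enumeration E

≢⇔≢ : ∀ {A B : Set} {f : A → B} → Injective _≡_ _≡_ f → ∀ {a b} → f a ≢ f b ⇔ a ≢ b
≢⇔≢ {f = f} injective = mk⇔ (λ fa≢fb a≡b → fa≢fb (cong f a≡b)) (λ a≢b fa≡fb → a≢b (injective fa≡fb))

module _ {n} (G : Graph n) where

  Clique : Subset n → Set
  Clique S = ∀ u v → u ∈ S → v ∈ S → u ≢ v → Edge G u v

  NoEdgeAcross : Subset n → Subset n → Set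
  NoEdgeAcross A B = ∀ {u v} → u ∈ A ∪ B → v ∈ A ∪ B → Edge G u v → u ∈ A × v ∈ A ⊎ u ∈ B × v ∈ B

  Edge-irrefl : ∀ {u v} → Edge G u v → u ≢ v
  Edge-irrefl {u} uu refl with trans (sym (adj-irrefl G u)) uu
  ... | ()

  clique⇒K : ∀ {S k} → ∣ S ∣ ≡ k → Clique S → InducedIso G S (K k)
  clique⇒K {S} {k} ∣S∣≡k clique = inducedIso {G = G} {F = K k} E λ a b →
    ⇔-sym (Edge-K a b) ⇔-∘ (≢⇔≢ injective ⇔-∘ mk⇔ Edge-irrefl (clique _ _ (φ∈S a) (φ∈S b)))
    where
      E : Enumeration S k
      E = enumeration ∣S∣≡k
      open Enumeration E

  module _ {A B : Subset n} (cliqueA : Clique A) (cliqueB : Clique B) (noEdgeAcross : NoEdgeAcross A B) where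

    Edge⇔sameClique : ∀ {u v} → u ∈ A ∪ B → v ∈ A ∪ B →
      Edge G u v ⇔ (u ≢ v × (u ∈ A × v ∈ A ⊎ u ∈ B × v ∈ B))
    Edge⇔sameClique u∈ v∈ = mk⇔ (λ uv → Edge-irrefl uv , noEdgeAcross u∈ v∈ uv) λ where
      (u≢v , inj₁ (u∈A , v∈A)) → cliqueA _ _ u∈A v∈A u≢v
      (u≢v , inj₂ (u∈B , v∈B)) → cliqueB _ _ u∈B v∈B u≢v

    twoCliques⇒L : ∀ {k r} → r ≤ k → ∣ A ∣ ≡ k → ∣ B ∣ ≡ k → ∣ A ∩ B ∣ ≡ k ∸ r →
      InducedIso G (A ∪ B) (L k r)
    twoCliques⇒L {r = r} r≤k ∣A∣≡k ∣B∣≡k ∣A∩B∣≡k∸r with m≤n⇒∃[o]m+o≡n r≤k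
    ... | s , refl = inducedIso {G = G} {F = L (r + s) r} E λ a b →
      ⇔-sym (Edge-L a b) ⇔-∘
        ((≢⇔≢ injective ×-⇔ ((∈A⇔ a ×-⇔ ∈A⇔ b) ⊎-⇔ (∈B⇔ a ×-⇔ ∈B⇔ b))) ⇔-∘ Edge⇔sameClique (φ∈S a) (φ∈S b))
      where
        ∣A∩B∣≡s : ∣ A ∩ B ∣ ≡ s
        ∣A∩B∣≡s = trans ∣A∩B∣≡k∸r (m+n∸m≡n r s)
        E₁ : Enumeration (A ∩ ∁ B) r
        E₁ = enumeration (∣p∣≡r+s⇒∣p∩q∣≡s⇒∣p∩∁q∣≡r A B ∣A∣≡k ∣A∩B∣≡s)
        E₂ : Enumeration (A ∩ B) s
        E₂ = enumeration ∣A∩B∣≡s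
        E₃ : Enumeration (B ∩ ∁ A) r
        E₃ = enumeration (∣p∣≡r+s⇒∣p∩q∣≡s⇒∣p∩∁q∣≡r B A ∣B∣≡k (trans (cong ∣_∣ (∩-comm B A)) ∣A∩B∣≡s))
        E : Enumeration (A ∪ B) ((r + s) + r)
        E = subst-Enumeration (p∩∁q∪p∩q∪q∩∁p≡p∪q A B)
              (enumeration-∪ (enumeration-∪ E₁ E₂ disjoint₁₂) E₃ disjoint₁₂₃)
          where
            disjoint₁₂ : ∀ {x} → x ∈ A ∩ ∁ B → x ∉ A ∩ B
            disjoint₁₂ x∈A∖B x∈A∩B = x∈∁p⇒x∉p (p∩q⊆q A (∁ B) x∈A∖B) (p∩q⊆q A B x∈A∩B)
            disjoint₁₂₃ : ∀ {x} → x ∈ A ∩ ∁ B ∪ A ∩ B → x ∉ B ∩ ∁ A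
            disjoint₁₂₃ x∈ x∈B∖A = x∈∁p⇒x∉p (p∩q⊆q B (∁ A) x∈B∖A)
              ([ p∩q⊆p A (∁ B) , p∩q⊆p A B ]′ (x∈p∪q⁻ (A ∩ ∁ B) (A ∩ B) x∈))
        open Enumeration E
        module E₁ = Enumeration E₁
        module E₂ = Enumeration E₂
        module E₃ = Enumeration E₃
        Located : Fin n → ℕ → Set
        Located w t = (w ∈ A ⇔ t < r + s) × (w ∈ B ⇔ r ≤ t)
        position : ∀ a → Located (φ a) (toℕ a)
        position a with split (r + s) r a
        ... | left a′ with split r s a′
        ...   | left x = subst₂ Located
          (sym (trans (lookup-++ˡ (E₁.φ ++ E₂.φ) E₃.φ (x ↑ˡ s)) (lookup-++ˡ E₁.φ E₂.φ x)))
          (sym (trans (toℕ-↑ˡ (x ↑ˡ s) r) (toℕ-↑ˡ x s)))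
          ( both-hold (p∩q⊆p A (∁ B) (E₁.φ∈S x)) (<-≤-trans (toℕ<n x) (m≤m+n r s))
          , both-fail (x∈∁p⇒x∉p (p∩q⊆q A (∁ B) (E₁.φ∈S x))) (<⇒≱ (toℕ<n x)))
        ...   | right y = subst₂ Located
          (sym (trans (lookup-++ˡ (E₁.φ ++ E₂.φ) E₃.φ (r ↑ʳ y)) (lookup-++ʳ E₁.φ E₂.φ y)))
          (sym (trans (toℕ-↑ˡ (r ↑ʳ y) r) (toℕ-↑ʳ r y)))
          ( both-hold (p∩q⊆p A B (E₂.φ∈S y)) (+-monoʳ-< r (toℕ<n y))
          , both-hold (p∩q⊆q A B (E₂.φ∈S y)) (m≤m+n r (toℕ y)))
        position a | right z = subst₂ Located
          (sym (lookup-++ʳ (E₁.φ ++ E₂.φ) E₃.φ z))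
          (sym (toℕ-↑ʳ (r + s) z))
          ( both-fail (x∈∁p⇒x∉p (p∩q⊆q B (∁ A) (E₃.φ∈S z))) (≤⇒≯ (m≤m+n (r + s) (toℕ z)))
          , both-hold (p∩q⊆p B (∁ A) (E₃.φ∈S z)) (≤-trans (m≤m+n r s) (m≤m+n (r + s) (toℕ z))))
        ∈A⇔ : ∀ a → φ a ∈ A ⇔ toℕ a < r + s
        ∈A⇔ = proj₁ ∘ position
        ∈B⇔ : ∀ a → φ a ∈ B ⇔ r ≤ toℕ a
        ∈B⇔ = proj₂ ∘ position

-- Unions of initial segments of a family

x∈⋃⁻ : ∀ (ps : List (Subset n)) {x} → x ∈ ⋃ ps → Any (x ∈_) ps
x∈⋃⁻ []       x∈ = ⊥-elim (∉⊥ x∈)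
x∈⋃⁻ (p ∷ ps) x∈ with x∈p∪q⁻ p (⋃ ps) x∈
... | inj₁ x∈p  = here x∈p
... | inj₂ x∈ps = there (x∈⋃⁻ ps x∈ps)

x∈⋃⁺ : ∀ {ps : List (Subset n)} {x} → Any (x ∈_) ps → x ∈ ⋃ ps
x∈⋃⁺ (here x∈p)  = x∈p∪q⁺ (inj₁ x∈p)
x∈⋃⁺ (there x∈ps) = x∈p∪q⁺ (inj₂ (x∈⋃⁺ x∈ps))

module _ {m} (U : Fin m → Subset n) where

  x∈unionBelow⁻ : ∀ {c x} → x ∈ unionBelow U c → ∃ λ i → toℕ i < c × x ∈ U i
  x∈unionBelow⁻ {c} x∈ =
    let i , i∈ , x∈Ui = List.find (Any.map⁻ (x∈⋃⁻ _ x∈))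
    in i , proj₂ (∈-filter⁻ (λ i → toℕ i <? c) {xs = allFin m} i∈) , x∈Ui

  x∈unionBelow⁺ : ∀ {c x} i → toℕ i < c → x ∈ U i → x ∈ unionBelow U c
  x∈unionBelow⁺ {c} i i<c x∈Ui =
    x∈⋃⁺ (Any.map⁺ (List.lose (∈-filter⁺ (λ i → toℕ i <? c) (∈-allFin i) i<c) x∈Ui))

  unionBelow-suc : ∀ i → unionBelow U (suc (toℕ i)) ≡ U i ∪ unionBelow U (toℕ i)
  unionBelow-suc i = ⊆-antisym ⊆∪ ∪⊆
    where
      ⊆∪ : unionBelow U (suc (toℕ i)) ⊆ U i ∪ unionBelow U (toℕ i)
      ⊆∪ x∈ with x∈unionBelow⁻ x∈
      ... | i′ , i′<1+i , x∈Ui′ with m<1+n⇒m<n∨m≡n i′<1+i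
      ...   | inj₁ i′<i = x∈p∪q⁺ (inj₂ (x∈unionBelow⁺ i′ i′<i x∈Ui′))
      ...   | inj₂ i′≡i = x∈p∪q⁺ (inj₁ (subst (λ i → _ ∈ U i) (toℕ-injective i′≡i) x∈Ui′))
      ∪⊆ : U i ∪ unionBelow U (toℕ i) ⊆ unionBelow U (suc (toℕ i))
      ∪⊆ x∈ with x∈p∪q⁻ (U i) (unionBelow U (toℕ i)) x∈
      ... | inj₁ x∈Ui = x∈unionBelow⁺ i (n<1+n (toℕ i)) x∈Ui
      ... | inj₂ x∈W  = let i′ , i′<i , x∈Ui′ = x∈unionBelow⁻ x∈W in x∈unionBelow⁺ i′ (m<n⇒m<1+n i′<i) x∈Ui′

  ∣unionBelow-suc∣ : ∀ {c} i → toℕ i ≡ c →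
    ∣ unionBelow U (suc c) ∣ + ∣ U i ∩ unionBelow U c ∣ ≡ ∣ U i ∣ + ∣ unionBelow U c ∣
  ∣unionBelow-suc∣ i refl =
    trans (cong (λ S → ∣ S ∣ + ∣ U i ∩ unionBelow U (toℕ i) ∣) (unionBelow-suc i))
          (∣p∪q∣+∣p∩q∣≡∣p∣+∣q∣ (U i) (unionBelow U (toℕ i)))

  unionBelow-zero : Empty (unionBelow U 0)
  unionBelow-zero (x , x∈) with x∈unionBelow⁻ x∈
  ... | _ , () , _

  module _ {d} (∣U∣≡1+d : ∀ i → ∣ U i ∣ ≡ suc d) (attached : ∀ i → 1 ≤ toℕ i → overlapPrev U i ≡ 1) where

    ∣unionBelow∣≡ : ∀ c → c < m → ∣ unionBelow U (suc c) ∣ ≡ suc d + c * d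
    ∣unionBelow∣≡ zero c<m = begin
      ∣ unionBelow U 1 ∣                            ≡⟨ +-identityʳ _ ⟨
      ∣ unionBelow U 1 ∣ + 0                        ≡⟨ cong (∣ unionBelow U 1 ∣ +_) overlap≡0 ⟨
      ∣ unionBelow U 1 ∣ + ∣ U i ∩ unionBelow U 0 ∣ ≡⟨ ∣unionBelow-suc∣ i (toℕ-fromℕ< c<m) ⟩
      ∣ U i ∣ + ∣ unionBelow U 0 ∣                  ≡⟨ cong₂ _+_ (∣U∣≡1+d i) (Empty⇒∣p∣≡0 unionBelow-zero) ⟩
      suc d + 0                                     ∎
      where
        i = fromℕ< c<m
        overlap≡0 : ∣ U i ∩ unionBelow U 0 ∣ ≡ 0
        overlap≡0 = Empty⇒∣p∣≡0 (unionBelow-zero ∘ map₂ (p∩q⊆q (U i) _))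
    ∣unionBelow∣≡ (suc c) c<m = +-cancelʳ-≡ 1 _ _ (begin
      ∣ unionBelow U (2 + c) ∣ + 1                              ≡⟨ cong (∣ unionBelow U (2 + c) ∣ +_) overlap≡1 ⟨
      ∣ unionBelow U (2 + c) ∣ + ∣ U i ∩ unionBelow U (suc c) ∣ ≡⟨ ∣unionBelow-suc∣ i (toℕ-fromℕ< c<m) ⟩
      ∣ U i ∣ + ∣ unionBelow U (suc c) ∣                        ≡⟨ cong₂ _+_ (∣U∣≡1+d i) previous ⟩
      suc d + (suc d + c * d)                                   ≡⟨ cong suc (+-suc d (d + c * d)) ⟩
      suc (suc (d + (d + c * d)))                               ≡⟨ +-comm 1 _ ⟩
      suc d + suc c * d + 1                                     ∎)
      where
        i = fromℕ< c<m
        previous : ∣ unionBelow U (suc c) ∣ ≡ suc d + c * d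
        previous = ∣unionBelow∣≡ c (<-trans (n<1+n c) c<m)
        overlap≡1 : ∣ U i ∩ unionBelow U (suc c) ∣ ≡ 1
        overlap≡1 = subst (λ c → ∣ U i ∩ unionBelow U c ∣ ≡ 1) (toℕ-fromℕ< c<m)
                          (attached i (subst (1 ≤_) (sym (toℕ-fromℕ< c<m)) (s≤s z≤n)))

-- Merging U_i and U_j

module _ {q} {i j : Fin (suc (suc q))} (i≢j : i ≢ j) where

  relabel : Fin (suc q) → Fin (suc (suc q))
  relabel = punchIn j ∘ transpose (fromℕ q) (punchOut (i≢j ∘ sym))

  relabel-injective : Injective _≡_ _≡_ relabel
  relabel-injective {s} {t} eq = begin
    s                                  ≡⟨ transpose-inverse _ _ ⟨
    transpose _ _ (transpose _ _ s)    ≡⟨ cong (transpose _ _) (punchIn-injective j _ _ eq) ⟩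
    transpose _ _ (transpose _ _ t)    ≡⟨ transpose-inverse _ _ ⟩
    t                                  ∎

  relabel-≢ : ∀ t → relabel t ≢ j
  relabel-≢ t = punchInᵢ≢i j _

  relabel-surjective : ∀ {m} → m ≢ j → ∃ λ t → relabel t ≡ m
  relabel-surjective m≢j = transpose _ _ (punchOut (m≢j ∘ sym)) ,
    trans (cong (punchIn j) (transpose-inverse _ _)) (punchIn-punchOut _)

  relabel-last : relabel (fromℕ q) ≡ i
  relabel-last = trans (cong (punchIn j) (transpose-matchˡ (fromℕ q) _)) (punchIn-punchOut _)
    where
      transpose-matchˡ : ∀ {m} (a b : Fin m) → transpose a b a ≡ b
      transpose-matchˡ a b rewrite dec-true (a ≟ a) refl = refl

module _ {n q} (U : Fin (suc (suc q)) → Subset n) where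

  record MergeablePair (c : ℕ) : Set where
    field
      i j       : Fin (suc (suc q))
      i<j       : toℕ i < toℕ j
      attached  : ∀ m → 1 ≤ toℕ m → m ≢ j → overlapPrev U m ≡ 1
      earlier⊆i : U j ∩ unionBelow U (toℕ j) ⊆ U i
      ∣Ui∩Uj∣≡  : ∣ U i ∩ U j ∣ ≡ c

  violates? : ∀ m → Dec (Violates U m)
  violates? m = (1 ≤? toℕ m) ×-dec ¬? (overlapPrev U m ℕ.≟ 1)

  ¬Violates⇒attached : ∀ m → 1 ≤ toℕ m → ¬ Violates U m → overlapPrev U m ≡ 1
  ¬Violates⇒attached m 1≤m ¬v = decidable-stable (overlapPrev U m ℕ.≟ 1) (λ ≢1 → ¬v (1≤m , ≢1))

  Ui∩Uj⊆earlier : ∀ {i j} → toℕ i < toℕ j → U i ∩ U j ⊆ U j ∩ unionBelow U (toℕ j)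
  Ui∩Uj⊆earlier {i} {j} i<j x∈ =
    let x∈Ui , x∈Uj = x∈p∩q⁻ (U i) (U j) x∈ in x∈p∩q⁺ (x∈Uj , x∈unionBelow⁺ U i i<j x∈Ui)

  violator⇒MergeablePair : ∀ {o} j → (∀ m → Violates U m → m ≡ j) → overlapPrev U j ≡ o →
    (∃ λ i → toℕ i < toℕ j × ∣ U i ∩ U j ∣ ≡ o) → MergeablePair o
  violator⇒MergeablePair j onlyViolator overlap≡o (i , i<j , ∣Ui∩Uj∣≡o) = record
    { i         = i
    ; j         = j
    ; i<j       = i<j
    ; attached  = λ m 1≤m m≢j → ¬Violates⇒attached m 1≤m (m≢j ∘ onlyViolator m)
    ; earlier⊆i = λ x∈ → p∩q⊆p (U i) (U j) (earlier⊆Ui∩Uj x∈)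
    ; ∣Ui∩Uj∣≡  = ∣Ui∩Uj∣≡o
    }
    where
      earlier⊆Ui∩Uj : U j ∩ unionBelow U (toℕ j) ⊆ U i ∩ U j
      earlier⊆Ui∩Uj = p⊆q⇒∣q∣≤∣p∣⇒q⊆p (Ui∩Uj⊆earlier i<j) (≤-reflexive (trans overlap≡o (sym ∣Ui∩Uj∣≡o)))

  noViolator⇒MergeablePair : ∀ {k r} → (∀ m → ¬ Violates U m) → 1 ≤ k → (∀ m → ∣ U m ∣ ≡ k) →
    r ≤ k ∸ 1 → n ≡ k + q * (k ∸ 1) + r → MergeablePair (k ∸ r)
  noViolator⇒MergeablePair {suc d} {r} noViolator (s≤s z≤n) ∣U∣≡k r≤d n≡ = record
    { i         = i
    ; j         = j
    ; i<j       = i<j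
    ; attached  = λ m 1≤m _ → attached m 1≤m
    ; earlier⊆i = λ y∈ → subst (_∈ U i) (∣p∣≡1⇒unique overlap≡1 x∈ y∈) x∈Ui
    ; ∣Ui∩Uj∣≡  = trans ∣Ui∩Uj∣≡1 (sym k∸r≡1)
    }
    where
      attached : ∀ m → 1 ≤ toℕ m → overlapPrev U m ≡ 1
      attached m 1≤m = ¬Violates⇒attached m 1≤m (noViolator m)
      j : Fin (suc (suc q))
      j = fromℕ (suc q)
      overlap≡1 : overlapPrev U j ≡ 1
      overlap≡1 = attached j (subst (1 ≤_) (sym (toℕ-fromℕ (suc q))) (s≤s z≤n))
      shared : Nonempty (U j ∩ unionBelow U (toℕ j))
      shared = 0<∣p∣⇒Nonempty _ (≤-reflexive (sym overlap≡1))
      x  = proj₁ shared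
      x∈ = proj₂ shared
      earlier : ∃ λ i → toℕ i < toℕ j × x ∈ U i
      earlier = x∈unionBelow⁻ U (p∩q⊆q (U j) _ x∈)
      i    = proj₁ earlier
      i<j  = proj₁ (proj₂ earlier)
      x∈Ui = proj₂ (proj₂ earlier)
      ∣Ui∩Uj∣≡1 : ∣ U i ∩ U j ∣ ≡ 1
      ∣Ui∩Uj∣≡1 = ≤-antisym (subst (∣ U i ∩ U j ∣ ≤_) overlap≡1 (p⊆q⇒∣p∣≤∣q∣ (Ui∩Uj⊆earlier i<j)))
                            (x∈p⇒0<∣p∣ (x∈p∩q⁺ (x∈Ui , p∩q⊆p (U j) _ x∈)))
      union≤n : suc d + (d + q * d) ≤ suc d + (q * d + r)
      union≤n = subst₂ _≤_ (∣unionBelow∣≡ U ∣U∣≡k attached (suc q) (n<1+n (suc q)))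
                           (trans n≡ (+-assoc (suc d) (q * d) r))
                           (∣p∣≤n (unionBelow U (suc (suc q))))
      d≤r : d ≤ r
      d≤r = +-cancelˡ-≤ (q * d) d r (subst (_≤ q * d + r) (+-comm d (q * d))
              (+-cancelˡ-≤ (suc d) (d + q * d) (q * d + r) union≤n))
      k∸r≡1 : suc d ∸ r ≡ 1
      k∸r≡1 = trans (cong (suc d ∸_) (≤-antisym r≤d d≤r)) (m+n∸n≡m 1 d)

  mergeablePair : ∀ {k r} → 1 ≤ k → r ≤ k ∸ 1 → n ≡ k + q * (k ∸ 1) + r → (∀ m → ∣ U m ∣ ≡ k) →
    (∀ j j′ → Violates U j → Violates U j′ → j ≡ j′) →
    (∀ j → Violates U j → overlapPrev U j ≡ k ∸ r × ∃ λ i → toℕ i < toℕ j × ∣ U i ∩ U j ∣ ≡ k ∸ r) →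
    MergeablePair (k ∸ r)
  mergeablePair 1≤k r≤k∸1 n≡ ∣U∣≡k uniqueViolator violator with any? violates?
  ... | yes (j , j-violates) = let overlap≡ , pair = violator j j-violates in
    violator⇒MergeablePair j (λ m m-violates → uniqueViolator m j m-violates j-violates) overlap≡ pair
  ... | no noViolator =
    noViolator⇒MergeablePair (λ m m-violates → noViolator (m , m-violates)) 1≤k ∣U∣≡k r≤k∸1 n≡

module _ {n q k r} {G : Graph n} {U : Fin (suc (suc q)) → Subset n} (P : MergeablePair U (k ∸ r))
         (cliques : ∀ m → Clique G (U m)) (covered : ∀ u v → Edge G u v → ∃ λ m → u ∈ U m × v ∈ U m) where

  open MergeablePair P

  private
    i≢j : i ≢ j
    i≢j i≡j = <-irrefl (cong toℕ i≡j) i<j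

    Uj∩earlier⊆Ui : ∀ {m x} → x ∈ U j → x ∈ U m → toℕ m < toℕ j → x ∈ U i
    Uj∩earlier⊆Ui {m} x∈Uj x∈Um m<j = earlier⊆i (x∈p∩q⁺ (x∈Uj , x∈unionBelow⁺ U m m<j x∈Um))

    merged : Fin (suc (suc q)) → Subset n
    merged m with m ≟ i
    ... | yes _ = U i ∪ U j
    ... | no _  = U m

    merged-i : merged i ≡ U i ∪ U j
    merged-i with i ≟ i
    ... | yes _  = refl
    ... | no i≢i = ⊥-elim (i≢i refl)

    merged-≢ : ∀ {m} → m ≢ i → merged m ≡ U m
    merged-≢ {m} m≢i with m ≟ i
    ... | yes m≡i = ⊥-elim (m≢i m≡i)
    ... | no _    = refl

    U⊆merged : ∀ m → U m ⊆ merged m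
    U⊆merged m with m ≟ i
    ... | yes refl = λ x∈ → x∈p∪q⁺ (inj₁ x∈)
    ... | no _     = λ x∈ → x∈

    x∈merged⁻ : ∀ {m x} → x ∈ merged m → x ∈ U m ⊎ (m ≡ i × x ∈ U j)
    x∈merged⁻ {m} x∈ with m ≟ i
    ... | yes refl = Sum.map₂ (refl ,_) (x∈p∪q⁻ (U i) (U j) x∈)
    ... | no _     = inj₁ x∈

    merged-meets-below : ∀ {m m₁ x} → m ≢ j → toℕ m₁ < toℕ m → x ∈ merged m → x ∈ merged m₁ →
      x ∈ U m ∩ unionBelow U (toℕ m)
    merged-meets-below {m} {m₁} m≢j m₁<m x∈m x∈m₁ with x∈merged⁻ x∈m | x∈merged⁻ x∈m₁
    ... | inj₁ x∈Um          | inj₁ x∈Um₁         = x∈p∩q⁺ (x∈Um , x∈unionBelow⁺ U m₁ m₁<m x∈Um₁)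
    ... | inj₂ (refl , x∈Uj) | inj₁ x∈Um₁         =
      x∈p∩q⁺ (Uj∩earlier⊆Ui x∈Uj x∈Um₁ (<-trans m₁<m i<j) , x∈unionBelow⁺ U m₁ m₁<m x∈Um₁)
    ... | inj₂ (refl , _)    | inj₂ (refl , _)    = ⊥-elim (<-irrefl refl m₁<m)
    ... | inj₁ x∈Um          | inj₂ (refl , x∈Uj) with <-cmp (toℕ j) (toℕ m)
    ...   | tri< j<m _ _ = x∈p∩q⁺ (x∈Um , x∈unionBelow⁺ U j j<m x∈Uj)
    ...   | tri≈ _ j≡m _ = ⊥-elim (m≢j (toℕ-injective (sym j≡m)))
    ...   | tri> _ _ m<j = x∈p∩q⁺ (x∈Um , x∈unionBelow⁺ U i m₁<m (Uj∩earlier⊆Ui x∈Uj x∈Um m<j))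

    E : Hypergraph n (suc q)
    E = merged ∘ relabel i≢j

    rank : Fin (suc q) → ℕ
    rank = toℕ ∘ relabel i≢j

    rank-injective : Injective _≡_ _≡_ rank
    rank-injective = relabel-injective i≢j ∘ toℕ-injective

    E-TreeOrdered : TreeOrdered E rank
    E-TreeOrdered e e₁ e₂ e₁<e e₂<e x∈e x∈e₁ y∈e y∈e₂ =
      ∣p∣≡1⇒unique (attached (relabel i≢j e) (≤-trans (s≤s z≤n) e₁<e) (relabel-≢ i≢j e))
        (merged-meets-below (relabel-≢ i≢j e) e₁<e x∈e x∈e₁)
        (merged-meets-below (relabel-≢ i≢j e) e₂<e y∈e y∈e₂)

    E-last : ∀ {t} → toℕ t ≡ q → E t ≡ U i ∪ U j
    E-last t≡q = trans (cong E (toℕ-injective (trans t≡q (sym (toℕ-fromℕ q)))))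
                       (trans (cong merged (relabel-last i≢j)) merged-i)

    relabel-≢i : ∀ {t} → t ≢ fromℕ q → relabel i≢j t ≢ i
    relabel-≢i t≢last σt≡i = t≢last (relabel-injective i≢j (trans σt≡i (sym (relabel-last i≢j))))

    E-other : ∀ {t} → toℕ t < q → E t ≡ U (relabel i≢j t)
    E-other t<q = merged-≢ (relabel-≢i λ t≡last → <-irrefl (trans (cong toℕ t≡last) (toℕ-fromℕ q)) t<q)

    covering : ∀ m → ∃ λ t → U m ⊆ E t
    covering m with m ≟ j
    ... | yes refl = fromℕ q , λ x∈ → subst (_ ∈_) (sym (E-last (toℕ-fromℕ q))) (x∈p∪q⁺ (inj₂ x∈))
    ... | no m≢j   = let t , σt≡m = relabel-surjective i≢j m≢j in
      t , λ x∈ → subst (λ m → _ ∈ merged m) (sym σt≡m) (U⊆merged m x∈)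

    noEdgeAcross : NoEdgeAcross G (U i) (U j)
    noEdgeAcross {u} {v} u∈ v∈ uv with covered u v uv
    ... | m , u∈Um , v∈Um with m ≟ i | m ≟ j
    ...   | yes refl | _        = inj₁ (u∈Um , v∈Um)
    ...   | no _     | yes refl = inj₂ (u∈Um , v∈Um)
    ...   | no m≢i   | no m≢j   = ⊥-elim (Edge-irrefl G uv (TreeOrdered⇒meet-unique rank-injective E-TreeOrdered
                                                 t≢last (∈Et u∈Um) (∈last u∈) (∈Et v∈Um) (∈last v∈)))
      where
        t = proj₁ (relabel-surjective i≢j m≢j)
        σt≡m = proj₂ (relabel-surjective i≢j m≢j)
        t≢last : t ≢ fromℕ q
        t≢last t≡last = m≢i (trans (sym σt≡m) (trans (cong (relabel i≢j) t≡last) (relabel-last i≢j)))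
        ∈Et : ∀ {x} → x ∈ U m → x ∈ E t
        ∈Et x∈ = subst (λ m → _ ∈ merged m) (sym σt≡m) (U⊆merged m x∈)
        ∈last : ∀ {x} → x ∈ U i ∪ U j → x ∈ E (fromℕ q)
        ∈last x∈ = subst (_ ∈_) (sym (E-last (toℕ-fromℕ q))) x∈

  mergedHypertree : Connected G → (∀ m → ∣ U m ∣ ≡ k) → r ≤ k → InGtreeqKL G q k (L k r)
  mergedHypertree connected ∣U∣≡k r≤k =
    E , TreeOrdered⇒Linear rank-injective E-TreeOrdered ,
    (hconnected , TreeOrdered⇒Acyclic rank-injective E-TreeOrdered) , edgeCovered , induced
    where
      edgeCovered : ∀ u v → Edge G u v → ∃ λ t → u ∈ E t × v ∈ E t
      edgeCovered u v uv =
        let m , u∈ , v∈ = covered u v uv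
            t , Um⊆Et   = covering m
        in t , Um⊆Et u∈ , Um⊆Et v∈
      hconnected : HConnected E
      hconnected u v = Star.map (λ {u} {v} → edgeCovered u v) (connected u v)
      induced : ∀ t → (toℕ t < q → InducedIso G (E t) (K k)) × (toℕ t ≡ q → InducedIso G (E t) (L k r))
      induced t =
        (λ t<q → subst (λ S → InducedIso G S (K k)) (sym (E-other t<q))
          (clique⇒K G (∣U∣≡k _) (cliques _))) ,
        (λ t≡q → subst (λ S → InducedIso G S (L k r)) (sym (E-last t≡q))
          (twoCliques⇒L G (cliques i) (cliques j) noEdgeAcross r≤k (∣U∣≡k i) (∣U∣≡k j) ∣Ui∩Uj∣≡))

mainTheorem4 : (k n q r : ℕ) → 3 ≤ k → 1 ≤ r → r ≤ k ∸ 1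
    → n ≡ k + q * (k ∸ 1) + r
    → (G : Graph n) → Connected G
    → (U : Fin (suc (suc q)) → Subset n)
    → (∀ i → ∣ U i ∣ ≡ k)
    → (∀ i u v → u ∈ U i → v ∈ U i → u ≢ v → Edge G u v)
    → (∀ u v → Edge G u v → ∃ λ i → u ∈ U i × v ∈ U i)
    → (∀ j j′ → Violates U j → Violates U j′ → j ≡ j′)
    → (∀ j → Violates U j →
         overlapPrev U j ≡ k ∸ r
         × ∃ λ i → toℕ i < toℕ j × ∣ U i ∩ U j ∣ ≡ k ∸ r)
    → InGtreeqKL G q k (L k r)
mainTheorem4 k n q r 3≤k _ r≤k∸1 n≡ G connected U ∣U∣≡k cliques covered uniqueViolator violator =
  mergedHypertree {k = k} {r = r} {G = G} pair cliques covered connected ∣U∣≡k (≤-trans r≤k∸1 (m∸n≤m k 1))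
  where
    pair : MergeablePair U (k ∸ r)
    pair = mergeablePair U (≤-trans (s≤s z≤n) 3≤k) r≤k∸1 n≡ ∣U∣≡k uniqueViolator violator
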